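{- If all functors in $\mathcal{F}=(F_s)_{s\in S}$ weakly preserve pullbacks, then the maps $\Sigma^L(-)$ from families of normal lax extensions of $\mathcal{F}$ to normal lax extensions of $\Sigma(\mathcal{F})$, and $c^\ast(-)$ in the opposite direction, are inverse to each other.
   Context: $\mathcal{F}=(F_s)_{s\in S}$ is a family of set functors and $\Sigma(\mathcal{F})X=\sum_{s\in S}F_sX$ with coprojections $c^s_X\colon F_sX\to\Sigma(\mathcal{F})X$. A lax extension of a functor $F$ is a monotone assignment of $Lr\subseteq FX\times FY$ to each relation $r\subseteq X\times Y$ with $Ff\le Lf$, $(Ff)^\circ\le L(f^\circ)$ for all functions $f$, and $Ls\cdot Lr\le L(s\cdot r)$ (applicative relational composition, $^\circ$ = converse); it is normal if $L1_X=1_{FX}$. For a family $\mathcal{L}=(L_s)_{s\in S}$ of (normal) lax extensions with $L_s$ extending $F_s$, $\Sigma^L(\mathcal{L})r=\bigvee_{s\in S}c^s_Y\cdot L_sr\cdot(c^s_X)^\circ$. For a lax extension $L$ of $\Sigma(\mathcal{F})$, $c^\ast(L)_s(r)=(c^s_Y)^\circ\cdot Lr\cdot c^s_X$. Both maps restrict to normal lax extensions and are ordered pointwise. -}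

module Defs where

open import Level using (0ℓ)
open import Data.Product using (Σ; ∃; _×_; _,_; proj₁; proj₂)
open import Relation.Binary.PropositionalEquality using (_≡_; refl; cong)
open import Function using (_∘_; id)

record SetFunctor : Set₁ where
  field
    F₀     : Set → Set
    map    : {X Y : Set} → (X → Y) → F₀ X → F₀ Y
    map-cong : {X Y : Set} {f g : X → Y} → (∀ x → f x ≡ g x) → ∀ a → map f a ≡ map g a
    map-id : {X : Set} (a : F₀ X) → map (λ x → x) a ≡ a
    map-∘  : {X Y Z : Set} (g : Y → Z) (f : X → Y) (a : F₀ X) →
             map (λ x → g (f x)) a ≡ map g (map f a)
open SetFunctor public

record IsWeakPullback {X Y Z P : Set} (f : X → Z) (g : Y → Z)
                      (p₁ : P → X) (p₂ : P → Y) : Set₁ where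
  field
    commutes : ∀ w → f (p₁ w) ≡ g (p₂ w)
    factor   : (Q : Set) (q₁ : Q → X) (q₂ : Q → Y) → (∀ q → f (q₁ q) ≡ g (q₂ q)) →
               Σ (Q → P) λ u → (∀ q → p₁ (u q) ≡ q₁ q) × (∀ q → p₂ (u q) ≡ q₂ q)

record IsPullback {X Y Z P : Set} (f : X → Z) (g : Y → Z)
                  (p₁ : P → X) (p₂ : P → Y) : Set₁ where
  field
    weak   : IsWeakPullback f g p₁ p₂
    unique : (Q : Set) (u v : Q → P) →
             (∀ q → p₁ (u q) ≡ p₁ (v q)) → (∀ q → p₂ (u q) ≡ p₂ (v q)) →
             ∀ q → u q ≡ v q

WeaklyPreservesPullbacks : SetFunctor → Set₁
WeaklyPreservesPullbacks 𝔽 =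
  {X Y Z P : Set} (f : X → Z) (g : Y → Z) (p₁ : P → X) (p₂ : P → Y) →
  IsPullback f g p₁ p₂ →
  IsWeakPullback (map 𝔽 f) (map 𝔽 g) (map 𝔽 p₁) (map 𝔽 p₂)

Rel : Set → Set → Set₁
Rel X Y = X → Y → Set

_⊆_ : {X Y : Set} → Rel X Y → Rel X Y → Set
r ⊆ s = ∀ x y → r x y → s x y

_≅_ : {X Y : Set} → Rel X Y → Rel X Y → Set
r ≅ s = (r ⊆ s) × (s ⊆ r)

⟪_⟫ : {X Y : Set} → (X → Y) → Rel X Y
⟪ f ⟫ x y = f x ≡ y

1R : (X : Set) → Rel X X
1R X x y = x ≡ y

_° : {X Y : Set} → Rel X Y → Rel Y X
(r °) y x = r x y

_·_ : {X Y Z : Set} → Rel Y Z → Rel X Y → Rel X Z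
(s · r) x z = ∃ λ y → r x y × s y z
infixr 9 _·_

⋁ : (S : Set) {X Y : Set} → (S → Rel X Y) → Rel X Y
⋁ S R x y = Σ S λ s → R s x y

RelAssign : SetFunctor → Set₁
RelAssign 𝔽 = {X Y : Set} → Rel X Y → Rel (F₀ 𝔽 X) (F₀ 𝔽 Y)

record IsLaxExtension (𝔽 : SetFunctor) (L : RelAssign 𝔽) : Set₁ where
  field
    monotone : {X Y : Set} {r r' : Rel X Y} → r ⊆ r' → L r ⊆ L r'
    L1 : {X Y : Set} (f : X → Y) → ⟪ map 𝔽 f ⟫ ⊆ L ⟪ f ⟫
    L2 : {X Y : Set} (f : X → Y) → (⟪ map 𝔽 f ⟫ °) ⊆ L (⟪ f ⟫ °)
    L3 : {X Y Z : Set} (r : Rel X Y) (s : Rel Y Z) → (L s · L r) ⊆ L (s · r)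

IsNormal : (𝔽 : SetFunctor) → RelAssign 𝔽 → Set₁
IsNormal 𝔽 L = (X : Set) → L (1R X) ≅ 1R (F₀ 𝔽 X)

record NormalLaxExtension (𝔽 : SetFunctor) : Set₁ where
  field
    L      : RelAssign 𝔽
    isLax  : IsLaxExtension 𝔽 L
    normal : IsNormal 𝔽 L
open NormalLaxExtension public

ΣF : (S : Set) → (S → SetFunctor) → SetFunctor
ΣF S 𝓕 = record
  { F₀ = λ X → Σ S λ s → F₀ (𝓕 s) X
  ; map = λ f → λ { (s , a) → s , map (𝓕 s) f a }
  ; map-cong = λ { e (s , a) → cong (s ,_) (map-cong (𝓕 s) e a) }
  ; map-id = λ { (s , a) → cong (s ,_) (map-id (𝓕 s) a) }
  ; map-∘ = λ { g f (s , a) → cong (s ,_) (map-∘ (𝓕 s) g f a) }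
  }

c : {S : Set} (𝓕 : S → SetFunctor) (s : S) {X : Set} → F₀ (𝓕 s) X → F₀ (ΣF S 𝓕) X
c 𝓕 s a = s , a

ΣL : (S : Set) (𝓕 : S → SetFunctor) → ((s : S) → RelAssign (𝓕 s)) → RelAssign (ΣF S 𝓕)
ΣL S 𝓕 𝓛 r = ⋁ S λ s → ⟪ c 𝓕 s ⟫ · 𝓛 s r · (⟪ c 𝓕 s ⟫ °)

c* : (S : Set) (𝓕 : S → SetFunctor) → RelAssign (ΣF S 𝓕) → (s : S) → RelAssign (𝓕 s)
c* S 𝓕 L s r = (⟪ c 𝓕 s ⟫ °) · L r · ⟪ c 𝓕 s ⟫

-- c*(Σ^L 𝓛) = 𝓛 is pure bookkeeping: conjugating the join by c^s picks out its s-th summand.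
-- For Σ^L(c* L) = L one needs that L r never relates elements of different summands. For a
-- normal lax extension, L ⟪ f ⟫ ⊆ ⟪ F f ⟫; composing L r with L ⟪ ! ⟫ for the map ! to the
-- one-point set then shows that L r-related elements have the same image under F !, and for
-- Σ(𝓕) that image records the summand.
module Submission where

open import Defs
open import Data.Product using (_×_; _,_; proj₁)
open import Data.Unit using (⊤; tt)
open import Relation.Binary.PropositionalEquality using (_≡_; refl; sym; trans; cong)

module _ {𝔽 : SetFunctor} (N : NormalLaxExtension 𝔽) where
  open IsLaxExtension (isLax N)

  L-graph⊆graph-map : {X Y : Set} (f : X → Y) → L N ⟪ f ⟫ ⊆ ⟪ map 𝔽 f ⟫
  L-graph⊆graph-map {Y = Y} f a b h =
    proj₁ (normal N Y) (map 𝔽 f a) b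
      (monotone graph·graph°⊆1 (map 𝔽 f a) b
        (L3 (⟪ f ⟫ °) ⟪ f ⟫ (map 𝔽 f a) b (a , L2 f (map 𝔽 f a) a refl , h)))
    where
    graph·graph°⊆1 : (⟪ f ⟫ · (⟪ f ⟫ °)) ⊆ 1R Y
    graph·graph°⊆1 _ _ (_ , fx≡y , fx≡y') = trans (sym fx≡y) fx≡y'

  L-preserves-shape : {X Y : Set} (r : Rel X Y) {a : F₀ 𝔽 X} {b : F₀ 𝔽 Y} →
                      L N r a b → map 𝔽 (λ _ → tt) a ≡ map 𝔽 (λ _ → tt) b
  L-preserves-shape {X} {Y} r {a} {b} h =
    L-graph⊆graph-map !X a (map 𝔽 !Y b)
      (monotone !Y·r⊆!X a (map 𝔽 !Y b) (L3 r ⟪ !Y ⟫ a (map 𝔽 !Y b) (b , h , L1 !Y b _ refl)))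
    where
    !X : X → ⊤
    !X _ = tt
    !Y : Y → ⊤
    !Y _ = tt
    !Y·r⊆!X : (⟪ !Y ⟫ · r) ⊆ ⟪ !X ⟫
    !Y·r⊆!X _ _ _ = refl

module _ (S : Set) (𝓕 : S → SetFunctor) where

  c*-ΣL : (𝓛 : (s : S) → RelAssign (𝓕 s)) (s : S) {X Y : Set} (r : Rel X Y) →
          c* S 𝓕 (ΣL S 𝓕 𝓛) s r ≅ 𝓛 s r
  c*-ΣL 𝓛 s r = to , from
    where
    to : c* S 𝓕 (ΣL S 𝓕 𝓛) s r ⊆ 𝓛 s r
    to _ _ (_ , (_ , refl , (_ , _ , (_ , refl , h) , refl)) , refl) = h
    from : 𝓛 s r ⊆ c* S 𝓕 (ΣL S 𝓕 𝓛) s r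
    from a b h = (s , b) , ((s , a) , refl , (s , b , (a , refl , h) , refl)) , refl

  ΣL-c*⊆ : (L' : RelAssign (ΣF S 𝓕)) {X Y : Set} (r : Rel X Y) → ΣL S 𝓕 (c* S 𝓕 L') r ⊆ L' r
  ΣL-c*⊆ L' r _ _ (_ , _ , (_ , refl , (_ , (_ , refl , h) , refl)) , refl) = h

  ΣL-c* : (𝕃 : NormalLaxExtension (ΣF S 𝓕)) {X Y : Set} (r : Rel X Y) →
          ΣL S 𝓕 (c* S 𝓕 (L 𝕃)) r ≅ L 𝕃 r
  ΣL-c* 𝕃 r = ΣL-c*⊆ (L 𝕃) r , from
    where
    from : L 𝕃 r ⊆ ΣL S 𝓕 (c* S 𝓕 (L 𝕃)) r
    from (s , a) (t , b) h with cong proj₁ (L-preserves-shape 𝕃 r h)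
    ... | refl = s , b , (a , refl , ((s , b) , ((s , a) , refl , h) , refl)) , refl

theorem43 : (S : Set) (𝓕 : S → SetFunctor) →
            ((s : S) → WeaklyPreservesPullbacks (𝓕 s)) →
            ((𝓛 : (s : S) → NormalLaxExtension (𝓕 s)) →
               (s : S) {X Y : Set} (r : Rel X Y) →
               c* S 𝓕 (ΣL S 𝓕 (λ t → L (𝓛 t))) s r ≅ L (𝓛 s) r)
            ×
            ((𝕃 : NormalLaxExtension (ΣF S 𝓕)) {X Y : Set} (r : Rel X Y) →
               ΣL S 𝓕 (c* S 𝓕 (L 𝕃)) r ≅ L 𝕃 r)
theorem43 S 𝓕 _ = (λ 𝓛 → c*-ΣL S 𝓕 (λ t → L (𝓛 t))) , ΣL-c* S 𝓕
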